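{- Let $a, b, n$ be positive integers with $n\le a$ and $n\le b$, and let $\preceq_{sd}$ be the strong dominance partial ordering of $[a]\times [b]$. Let $S\subseteq [a]\times [b]$ be a set containing no chain (with respect to $\preceq_{sd}$) of length greater than $n$. Then $|S| \le n(a+b -n)$.
   Context: $[k]=\{1,\dots,k\}$. For $S\subseteq\mathbb R^d$, the strong dominance partial order $\preceq_{sd}$ on $S$ is defined by $u\preceq_{sd} v$ iff $u=v$ or every coordinate of $v$ is strictly greater than the corresponding coordinate of $u$. The length of a chain is its number of elements. -}

module Defs where

open import Data.Nat using (ℕ; _<_)
open import Data.Fin using (Fin; toℕ)
open import Data.Product using (_×_; proj₁; proj₂)
open import Data.Sum using (_⊎_)
open import Data.List using (List)
open import Data.List.Relation.Unary.All using (All)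
open import Data.List.Relation.Unary.Unique.Propositional using (Unique)
open import Data.List.Relation.Unary.AllPairs using (AllPairs)
open import Relation.Binary.PropositionalEquality using (_≡_)
open import Data.List.Membership.Propositional using (_∈_)

-- The grid [a] × [b]; Fin a represents [a] via i ↦ toℕ i + 1 (order-preserving).
Point : ℕ → ℕ → Set
Point a b = Fin a × Fin b

_⪯sd_ : ∀ {a b} → Point a b → Point a b → Set
u ⪯sd v = (u ≡ v) ⊎ ((toℕ (proj₁ u) < toℕ (proj₁ v)) × (toℕ (proj₂ u) < toℕ (proj₂ v)))

Comparable : ∀ {a b} → Point a b → Point a b → Set
Comparable u v = (u ⪯sd v) ⊎ (v ⪯sd u)

-- a finite set S ⊆ [a] × [b], represented as a duplicate-free list
-- a chain in S: a duplicate-free list of elements of S, pairwise comparable;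
-- its length is its number of elements
IsChainIn : ∀ {a b} → List (Point a b) → List (Point a b) → Set
IsChainIn S C = Unique C × All (λ x → x ∈ S) C × AllPairs Comparable C

-- Cut the grid into the a + b − 1 diagonals j − i = const. Two points of one diagonal are equal or
-- strictly dominate one another, so S meets the k-th diagonal in a chain: at most n points. Along a
-- diagonal both coordinates are injective, which bounds the same intersection by k + 1 and by
-- a + b − 1 − k. Summing the trapezoid min(n, k + 1, a + b − 1 − k) over k gives n (a + b − n).
module Submission where

open import Defs
open import Data.Fin using (toℕ)
open import Data.Fin.Properties using (toℕ<n; toℕ≤pred[n]; toℕ-injective)
open import Data.List using (List; []; _∷_; [_]; length; filter)
open import Data.List.Properties using (filter-accept; filter-++; length-++)
open import Data.List.Relation.Binary.Subset.Propositional.Properties using (filter-⊆)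
open import Data.List.Relation.Unary.All as All using (All; []; _∷_)
import Data.List.Relation.Unary.All.Properties as All
open import Data.List.Relation.Unary.AllPairs using (AllPairs; []; _∷_)
open import Data.List.Relation.Unary.Unique.Propositional using (Unique)
import Data.List.Relation.Unary.Unique.Propositional.Properties as Unique
open import Data.Nat using (ℕ; zero; suc; _≤_; _<_; _+_; _*_; _∸_; _⊓_; z≤n; s≤s; _≟_)
open import Data.Nat.Properties
open import Algebra.Properties.CommutativeSemigroup +-commutativeSemigroup using (interchange; x∙yz≈y∙xz)
open import Data.Nat.Tactic.RingSolver using (solve-∀)
open import Data.Product using (_×_; _,_; proj₁; proj₂)
open import Data.Product.Properties using (×-≡,≡→≡)
open import Data.Sum using (_⊎_; inj₁; inj₂)
open import Function using (_∘_)
open import Relation.Binary.Definitions using (tri<; tri≈; tri>)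
open import Relation.Binary.PropositionalEquality using (_≡_; refl; sym; trans; cong; cong₂; subst)
open import Relation.Nullary using (contradiction)

open ≤-Reasoning

∑< : ℕ → (ℕ → ℕ) → ℕ
∑< zero    f = 0
∑< (suc K) f = ∑< K f + f K

syntax ∑< K (λ k → e) = ∑[ k < K ] e

module _ {f g : ℕ → ℕ} where

  ∑-cong : ∀ K → (∀ k → k < K → f k ≡ g k) → ∑[ k < K ] f k ≡ ∑[ k < K ] g k
  ∑-cong zero    _   = refl
  ∑-cong (suc K) f≡g = cong₂ _+_ (∑-cong K λ k k<K → f≡g k (m<n⇒m<1+n k<K)) (f≡g K ≤-refl)

  ∑-mono-≤ : ∀ K → (∀ k → k < K → f k ≤ g k) → ∑[ k < K ] f k ≤ ∑[ k < K ] g k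
  ∑-mono-≤ zero    _   = z≤n
  ∑-mono-≤ (suc K) f≤g = +-mono-≤ (∑-mono-≤ K λ k k<K → f≤g k (m<n⇒m<1+n k<K)) (f≤g K ≤-refl)

  ∑-distrib-+ : ∀ K → ∑[ k < K ] (f k + g k) ≡ ∑[ k < K ] f k + ∑[ k < K ] g k
  ∑-distrib-+ zero    = refl
  ∑-distrib-+ (suc K) = begin-equality
    ∑[ k < K ] (f k + g k) + (f K + g K)           ≡⟨ cong (_+ (f K + g K)) (∑-distrib-+ K) ⟩
    ∑[ k < K ] f k + ∑[ k < K ] g k + (f K + g K)  ≡⟨ interchange (∑[ k < K ] f k) (∑[ k < K ] g k) (f K) (g K) ⟩
    ∑[ k < K ] f k + f K + (∑[ k < K ] g k + g K)  ∎

∑-const : ∀ K c → ∑[ k < K ] c ≡ K * c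
∑-const zero    c = refl
∑-const (suc K) c = trans (cong (_+ c) (∑-const K c)) (+-comm (K * c) c)

term-≤-∑ : ∀ (f : ℕ → ℕ) {j K} → j < K → f j ≤ ∑[ k < K ] f k
term-≤-∑ f {j} {suc K} j<1+K with m≤n⇒m<n∨m≡n (≤-pred j<1+K)
... | inj₁ j<K  = ≤-trans (term-≤-∑ f j<K) (m≤m+n _ (f K))
... | inj₂ refl = m≤n+m (f j) _

∑-peel-first : ∀ (f : ℕ → ℕ) K → ∑[ k < suc K ] f k ≡ f 0 + ∑[ k < K ] f (suc k)
∑-peel-first f zero    = +-comm 0 (f 0)
∑-peel-first f (suc K) = trans (cong (_+ f (suc K)) (∑-peel-first f K)) (+-assoc (f 0) _ _)

∑-reverse : ∀ (f : ℕ → ℕ) K → ∑[ k < K ] f (K ∸ suc k) ≡ ∑[ k < K ] f k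
∑-reverse f zero    = refl
∑-reverse f (suc K) = begin-equality
  ∑[ k < suc K ] f (K ∸ k)          ≡⟨ ∑-peel-first (λ k → f (K ∸ k)) K ⟩
  f K + ∑[ k < K ] f (K ∸ suc k)    ≡⟨ cong (f K +_) (∑-reverse f K) ⟩
  f K + ∑[ k < K ] f k              ≡⟨ +-comm (f K) _ ⟩
  ∑[ k < K ] f k + f K              ∎

double-∑-suc : ∀ K → 2 * ∑[ k < K ] suc k ≡ K * suc K
double-∑-suc zero    = refl
double-∑-suc (suc K) = begin-equality
  2 * (∑[ k < K ] suc k + suc K)      ≡⟨ *-distribˡ-+ 2 (∑[ k < K ] suc k) (suc K) ⟩
  2 * ∑[ k < K ] suc k + 2 * suc K    ≡⟨ cong (_+ 2 * suc K) (double-∑-suc K) ⟩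
  K * suc K + 2 * suc K               ≡⟨ expand K ⟩
  suc K * suc (suc K)                 ∎
  where expand : ∀ K → K * suc K + 2 * suc K ≡ suc K * suc (suc K)
        expand = solve-∀

∑-⊓-suc : ∀ n d → ∑[ k < d + n ] (n ⊓ suc k) ≡ ∑[ k < n ] suc k + d * n
∑-⊓-suc n zero    = trans (∑-cong n λ k k<n → m≥n⇒m⊓n≡n k<n) (sym (+-identityʳ _))
∑-⊓-suc n (suc d) = begin-equality
  ∑[ k < d + n ] (n ⊓ suc k) + n ⊓ suc (d + n)  ≡⟨ cong₂ _+_ (∑-⊓-suc n d) (m≤n⇒m⊓n≡m (m≤n+m n (suc d))) ⟩
  ∑[ k < n ] suc k + d * n + n                  ≡⟨ +-assoc (∑[ k < n ] suc k) (d * n) n ⟩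
  ∑[ k < n ] suc k + (d * n + n)                ≡⟨ cong (∑[ k < n ] suc k +_) (+-comm (d * n) n) ⟩
  ∑[ k < n ] suc k + suc d * n                  ∎

+-≤-⊓+⊓ : ∀ {m n x y} → n + n ≤ x + y → m ≤ n → m ≤ x → m ≤ y → m + n ≤ n ⊓ x + n ⊓ y
+-≤-⊓+⊓ {m} {n} {x} {y} n+n≤x+y m≤n m≤x m≤y with ≤-total n x
... | inj₁ n≤x = begin
  m + n          ≤⟨ +-monoˡ-≤ n (⊓-glb m≤n m≤y) ⟩
  n ⊓ y + n      ≡⟨ +-comm (n ⊓ y) n ⟩
  n + n ⊓ y      ≡⟨ cong (_+ n ⊓ y) (sym (m≤n⇒m⊓n≡m n≤x)) ⟩
  n ⊓ x + n ⊓ y  ∎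
... | inj₂ x≤n = begin
  m + n          ≤⟨ +-monoˡ-≤ n m≤x ⟩
  x + n          ≡⟨ cong₂ _+_ (sym (m≥n⇒m⊓n≡n x≤n)) (sym (m≤n⇒m⊓n≡m n≤y)) ⟩
  n ⊓ x + n ⊓ y  ∎
  where
  n≤y : n ≤ y
  n≤y = +-cancelˡ-≤ n n y (≤-trans n+n≤x+y (+-monoˡ-≤ y x≤n))

m+m≤1+n⇒m≤n : ∀ {m n} → m + m ≤ suc n → m ≤ n
m+m≤1+n⇒m≤n {zero}  _               = z≤n
m+m≤1+n⇒m≤n {suc m} (s≤s m+1+m≤n) = m+n≤o⇒n≤o m m+1+m≤n

-- Since (k + 1) + (K − k) ≥ 2n, pairing the bounds gives c k + n ≤ n ⊓ (k + 1) + n ⊓ (K − k); the two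
-- halves of the right-hand side are mirror images with the same sum, computed by ∑-⊓-suc.
∑-≤-trapezoid : ∀ n K (c : ℕ → ℕ) → n + n ≤ suc K →
  (∀ k → k < K → c k ≤ n) → (∀ k → k < K → c k ≤ suc k) → (∀ k → k < K → c k ≤ K ∸ k) →
  ∑[ k < K ] c k ≤ n * (suc K ∸ n)
∑-≤-trapezoid n K c n+n≤1+K c≤n c≤1+k c≤K∸k with K ∸ n | m∸n+n≡m {K} {n} (m+m≤1+n⇒m≤n n+n≤1+K)
... | d | refl = +-cancelʳ-≤ (K′ * n + n * n) _ _ (begin
  ∑[ k < K′ ] c k + (K′ * n + n * n)   ≡⟨ +-assoc (∑[ k < K′ ] c k) (K′ * n) (n * n) ⟨
  ∑[ k < K′ ] c k + K′ * n + n * n     ≤⟨ +-monoˡ-≤ (n * n) paired ⟩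
  T + T + n * n                        ≡⟨ area ⟩
  n * (suc K′ ∸ n) + (K′ * n + n * n)  ∎)
  where
  K′ : ℕ
  K′ = d + n
  T : ℕ
  T = ∑[ k < K′ ] (n ⊓ suc k)

  mirror : ∑[ k < K′ ] (n ⊓ (K′ ∸ k)) ≡ T
  mirror = trans (∑-cong K′ λ k k<K′ → cong (n ⊓_) (+-∸-assoc 1 k<K′)) (∑-reverse (λ m → n ⊓ suc m) K′)

  paired : ∑[ k < K′ ] c k + K′ * n ≤ T + T
  paired = begin
    ∑[ k < K′ ] c k + K′ * n                      ≡⟨ cong (∑[ k < K′ ] c k +_) (∑-const K′ n) ⟨
    ∑[ k < K′ ] c k + ∑[ k < K′ ] n               ≡⟨ ∑-distrib-+ K′ ⟨
    ∑[ k < K′ ] (c k + n)                         ≤⟨ ∑-mono-≤ K′ c+n≤ ⟩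
    ∑[ k < K′ ] (n ⊓ suc k + n ⊓ (K′ ∸ k))        ≡⟨ ∑-distrib-+ K′ ⟩
    T + ∑[ k < K′ ] (n ⊓ (K′ ∸ k))                ≡⟨ cong (T +_) mirror ⟩
    T + T                                         ∎
    where
    c+n≤ : ∀ k → k < K′ → c k + n ≤ n ⊓ suc k + n ⊓ (K′ ∸ k)
    c+n≤ k k<K′ = +-≤-⊓+⊓ n+n≤1+k+[K′∸k] (c≤n k k<K′) (c≤1+k k k<K′) (c≤K∸k k k<K′)
      where
      n+n≤1+k+[K′∸k] : n + n ≤ suc k + (K′ ∸ k)
      n+n≤1+k+[K′∸k] = subst (n + n ≤_) (cong suc (sym (m+[n∸m]≡n (<⇒≤ k<K′)))) n+n≤1+K

  area : T + T + n * n ≡ n * (suc K′ ∸ n) + (K′ * n + n * n)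
  area = begin-equality
    T + T + n * n                                            ≡⟨ cong (λ t → t + t + n * n) (∑-⊓-suc n d) ⟩
    G + d * n + (G + d * n) + n * n                          ≡⟨ regroup G d n ⟩
    2 * G + (d * n + d * n + n * n)                          ≡⟨ cong (_+ (d * n + d * n + n * n)) (double-∑-suc n) ⟩
    n * suc n + (d * n + d * n + n * n)                      ≡⟨ expand n d ⟩
    n * suc d + (K′ * n + n * n)                             ≡⟨ cong (λ e → n * e + (K′ * n + n * n)) (m+n∸n≡m (suc d) n) ⟨
    n * (suc K′ ∸ n) + (K′ * n + n * n)                      ∎
    where
    G : ℕ
    G = ∑[ k < n ] suc k
    regroup : ∀ G d n → G + d * n + (G + d * n) + n * n ≡ 2 * G + (d * n + d * n + n * n)
    regroup = solve-∀
    expand : ∀ n d → n * suc n + (d * n + d * n + n * n) ≡ n * suc d + ((d + n) * n + n * n)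
    expand = solve-∀

module _ {A : Set} (key : A → ℕ) where

  fiber : List A → ℕ → List A
  fiber xs k = filter (λ x → key x ≟ k) xs

  length-≤-∑-fiber : ∀ {K} xs → All (λ x → key x < K) xs → length xs ≤ ∑[ k < K ] length (fiber xs k)
  length-≤-∑-fiber     []       []           = z≤n
  length-≤-∑-fiber {K} (x ∷ xs) (x<K ∷ xs<K) = begin
    1 + length xs
      ≡⟨ cong (λ n → n + length xs) (cong length (filter-accept (λ y → key y ≟ key x) refl)) ⟨
    length (fiber [ x ] (key x)) + length xs
      ≤⟨ +-mono-≤ (term-≤-∑ (λ k → length (fiber [ x ] k)) x<K) (length-≤-∑-fiber xs xs<K) ⟩
    ∑[ k < K ] length (fiber [ x ] k) + ∑[ k < K ] length (fiber xs k)
      ≡⟨ ∑-distrib-+ K ⟨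
    ∑[ k < K ] (length (fiber [ x ] k) + length (fiber xs k))
      ≡⟨ ∑-cong K (λ k _ → length-fiber-∷ k) ⟨
    ∑[ k < K ] length (fiber (x ∷ xs) k) ∎
    where
    length-fiber-∷ : ∀ k → length (fiber (x ∷ xs) k) ≡ length (fiber [ x ] k) + length (fiber xs k)
    length-fiber-∷ k = trans (cong length (filter-++ (λ y → key y ≟ k) [ x ] xs)) (length-++ (fiber [ x ] k))

subsingleton⇒length≤1 : ∀ {A : Set} {P : A → Set} {xs} →
  (∀ {x y} → P x → P y → x ≡ y) → Unique xs → All P xs → length xs ≤ 1
subsingleton⇒length≤1 _  _                []              = z≤n
subsingleton⇒length≤1 _  _                (_ ∷ [])        = ≤-refl
subsingleton⇒length≤1 eq ((x≢y ∷ _) ∷ _) (px ∷ py ∷ _) = contradiction (eq px py) x≢y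

pigeonhole : ∀ {A : Set} {Q : A → Set} (f : A → ℕ) {m xs} →
  (∀ {x y} → Q x → Q y → f x ≡ f y → x ≡ y) →
  Unique xs → All Q xs → All (λ x → f x < m) xs → length xs ≤ m
pigeonhole {Q = Q} f {m} {xs} f-injective xs! Qxs fxs<m = begin
  length xs                          ≤⟨ length-≤-∑-fiber f xs fxs<m ⟩
  ∑[ j < m ] length (fiber f xs j)   ≤⟨ ∑-mono-≤ m (λ j _ → fiber≤1 j) ⟩
  ∑[ j < m ] 1                       ≡⟨ ∑-const m 1 ⟩
  m * 1                              ≡⟨ *-identityʳ m ⟩
  m                                  ∎
  where
  fiber≤1 : ∀ j → length (fiber f xs j) ≤ 1
  fiber≤1 j = subsingleton⇒length≤1 {P = λ x → Q x × f x ≡ j}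
    (λ (qx , fx≡j) (qy , fy≡j) → f-injective qx qy (trans fx≡j (sym fy≡j)))
    (Unique.filter⁺ (λ x → f x ≟ j) xs!)
    (All.zip (All.filter⁺ (λ x → f x ≟ j) Qxs , All.all-filter (λ x → f x ≟ j) xs))

all⇒allPairs : ∀ {A : Set} {P : A → Set} {R : A → A → Set} {xs} →
  (∀ {x y} → P x → P y → R x y) → All P xs → AllPairs R xs
all⇒allPairs r []         = []
all⇒allPairs r (px ∷ pxs) = All.map (r px) pxs ∷ all⇒allPairs r pxs

_<sd_ : ∀ {a b} → Point a b → Point a b → Set
u <sd v = (toℕ (proj₁ u) < toℕ (proj₁ v)) × (toℕ (proj₂ u) < toℕ (proj₂ v))

m+p≡n+q∧q<p⇒m<n : ∀ {m n p q} → m + p ≡ n + q → q < p → m < n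
m+p≡n+q∧q<p⇒m<n {m} {n} {p} {q} m+p≡n+q q<p =
  +-cancelʳ-< p m n (subst (_< n + p) (sym m+p≡n+q) (+-monoʳ-< n q<p))

-- Rows are indexed by Fin (a′ + 1); the diagonals {j − i = const} are numbered 0, …, a′ + b − 1.
module Diagonals (a′ b : ℕ) where

  diagonal : Point (suc a′) b → ℕ
  diagonal (i , j) = toℕ j + (a′ ∸ toℕ i)

  diagonal< : ∀ x → diagonal x < a′ + b
  diagonal< (i , j) = begin-strict
    toℕ j + (a′ ∸ toℕ i)  <⟨ +-mono-<-≤ (toℕ<n j) (m∸n≤m a′ (toℕ i)) ⟩
    b + a′                ≡⟨ +-comm b a′ ⟩
    a′ + b                ∎

  diagonal-trichotomy : ∀ x y → diagonal x ≡ diagonal y → x ≡ y ⊎ x <sd y ⊎ y <sd x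
  diagonal-trichotomy (i , j) (i′ , j′) eq with <-cmp (toℕ i) (toℕ i′)
  ... | tri< i<i′ _ _ = inj₂ (inj₁ (i<i′ , m+p≡n+q∧q<p⇒m<n eq (∸-monoʳ-< i<i′ (toℕ≤pred[n] i′))))
  ... | tri> _ _ i′<i = inj₂ (inj₂ (i′<i , m+p≡n+q∧q<p⇒m<n (sym eq) (∸-monoʳ-< i′<i (toℕ≤pred[n] i))))
  ... | tri≈ _ i≡i′ _ = inj₁ (×-≡,≡→≡ (toℕ-injective i≡i′ , toℕ-injective j≡j′))
    where
    j≡j′ : toℕ j ≡ toℕ j′
    j≡j′ = +-cancelʳ-≡ (a′ ∸ toℕ i) _ _ (trans eq (cong (λ t → toℕ j′ + (a′ ∸ t)) (sym i≡i′)))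

  same-diagonal⇒comparable : ∀ {x y} → diagonal x ≡ diagonal y → Comparable x y
  same-diagonal⇒comparable {x} {y} eq with diagonal-trichotomy x y eq
  ... | inj₁ x≡y        = inj₁ (inj₁ x≡y)
  ... | inj₂ (inj₁ x<y) = inj₁ (inj₂ x<y)
  ... | inj₂ (inj₂ y<x) = inj₂ (inj₂ y<x)

  diagonal-injective : (f : Point (suc a′) b → ℕ) → (∀ {x y} → x <sd y → f x < f y) →
    ∀ {x y} → diagonal x ≡ diagonal y → f x ≡ f y → x ≡ y
  diagonal-injective f f-mono {x} {y} eq fx≡fy with diagonal-trichotomy x y eq
  ... | inj₁ x≡y        = x≡y
  ... | inj₂ (inj₁ x<y) = contradiction fx≡fy (<⇒≢ (f-mono x<y))
  ... | inj₂ (inj₂ y<x) = contradiction (sym fx≡fy) (<⇒≢ (f-mono y<x))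

  column<1+diagonal : ∀ x → toℕ (proj₂ x) < suc (diagonal x)
  column<1+diagonal (i , j) = s≤s (m≤m+n (toℕ j) (a′ ∸ toℕ i))

  row<K∸diagonal : ∀ x → toℕ (proj₁ x) < a′ + b ∸ diagonal x
  row<K∸diagonal (i , j) = m+n≤o⇒m≤o∸n (suc (toℕ i)) (begin
    suc (toℕ i + (toℕ j + (a′ ∸ toℕ i)))  ≡⟨ cong suc (x∙yz≈y∙xz (toℕ i) (toℕ j) (a′ ∸ toℕ i)) ⟩
    suc (toℕ j + (toℕ i + (a′ ∸ toℕ i)))  ≡⟨ cong (λ t → suc (toℕ j + t)) (m+[n∸m]≡n (toℕ≤pred[n] i)) ⟩
    suc (toℕ j + a′)                      ≤⟨ +-monoˡ-≤ a′ (toℕ<n j) ⟩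
    b + a′                                ≡⟨ +-comm b a′ ⟩
    a′ + b                                ∎)

  module _ {S : List (Point (suc a′) b)} (S! : Unique S) (k : ℕ) where

    onDiagonal : List (Point (suc a′) b)
    onDiagonal = fiber diagonal S k

    private
      onDiagonal! : Unique onDiagonal
      onDiagonal! = Unique.filter⁺ (λ x → diagonal x ≟ k) S!

      all-onDiagonal : All (λ x → diagonal x ≡ k) onDiagonal
      all-onDiagonal = All.all-filter (λ x → diagonal x ≟ k) S

      injective-onDiagonal : (f : Point (suc a′) b → ℕ) → (∀ {x y} → x <sd y → f x < f y) →
        ∀ {x y} → diagonal x ≡ k → diagonal y ≡ k → f x ≡ f y → x ≡ y
      injective-onDiagonal f f-mono dx≡k dy≡k = diagonal-injective f f-mono (trans dx≡k (sym dy≡k))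

    onDiagonal-isChain : IsChainIn S onDiagonal
    onDiagonal-isChain =
      onDiagonal! ,
      All.tabulate (filter-⊆ (λ x → diagonal x ≟ k) S) ,
      all⇒allPairs (λ dx≡k dy≡k → same-diagonal⇒comparable (trans dx≡k (sym dy≡k))) all-onDiagonal

    length-onDiagonal≤1+k : length onDiagonal ≤ suc k
    length-onDiagonal≤1+k = pigeonhole (toℕ ∘ proj₂)
      (injective-onDiagonal (toℕ ∘ proj₂) proj₂) onDiagonal! all-onDiagonal
      (All.map (λ { {x} refl → column<1+diagonal x }) all-onDiagonal)

    length-onDiagonal≤K∸k : length onDiagonal ≤ a′ + b ∸ k
    length-onDiagonal≤K∸k = pigeonhole (toℕ ∘ proj₁)
      (injective-onDiagonal (toℕ ∘ proj₁) proj₁) onDiagonal! all-onDiagonal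
      (All.map (λ { {x} refl → row<K∸diagonal x }) all-onDiagonal)

theorem9 : (a b n : ℕ) → 1 ≤ a → 1 ≤ b → 1 ≤ n →
    n ≤ a → n ≤ b →
    (S : List (Point a b)) → Unique S →
    ((C : List (Point a b)) → IsChainIn S C → length C ≤ n) →
    length S ≤ n * (a + b ∸ n)
theorem9 (suc a′) b n _ _ _ n≤a n≤b S S! chains≤n = begin
  length S                                    ≤⟨ length-≤-∑-fiber diagonal S (All.tabulate λ {x} _ → diagonal< x) ⟩
  ∑[ k < a′ + b ] length (onDiagonal S! k)    ≤⟨ ∑-≤-trapezoid n (a′ + b) _ (+-mono-≤ n≤a n≤b)
                                                   (λ k _ → chains≤n _ (onDiagonal-isChain S! k))
                                                   (λ k _ → length-onDiagonal≤1+k S! k)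
                                                   (λ k _ → length-onDiagonal≤K∸k S! k) ⟩
  n * (suc a′ + b ∸ n)                        ∎
  where open Diagonals a′ b
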